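{- For $n\ge 1$ let $X(n)$ be the number of parts of an Arndt composition of $n$ chosen uniformly at random. Then, as $n\to\infty$, $$\mathbb{E}[X(n)]\sim\left(\frac{3}{\sqrt 5}-1\right)n.$$
   Context: A composition of $n$ is a finite sequence $(\sigma_1,\dots,\sigma_\ell)$ of positive integers summing to $n$; $\ell$ is its number of parts. An Arndt composition is one with $\sigma_{2i-1}>\sigma_{2i}$ for every positive integer $i$ with $2i\le\ell$. -}

module Defs where

open import Data.Bool using (Bool; true; false; _∧_)
open import Data.Nat using (ℕ; zero; suc; _<ᵇ_)
open import Data.Nat.ListAction using (sum)
import Data.Nat as ℕ
open import Data.List using (List; []; _∷_; map; _++_; concatMap; length; filterᵇ)
open import Data.Integer using (+_)
open import Data.Rational using (ℚ; 0ℚ; _/_; _<_; _+_; _-_; _*_)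
open import Data.Product using (_×_)
open import Data.Sum using (_⊎_)

-- Compositions of n (finite sequences of positive integers summing to n),
-- enumerated structurally: a composition of n+1 either starts with a part 1
-- followed by a composition of n, or arises from a composition of n by
-- increasing its first part by one.  Each composition appears exactly once.
private
  incHead : List ℕ → List (List ℕ)
  incHead []      = []
  incHead (a ∷ r) = (suc a ∷ r) ∷ []

compositions : ℕ → List (List ℕ)
compositions zero    = [] ∷ []
compositions (suc n) = map (1 ∷_) (compositions n) ++ concatMap incHead (compositions n)

isArndt : List ℕ → Bool
isArndt []          = true
isArndt (a ∷ [])    = true
isArndt (a ∷ b ∷ r) = (b <ᵇ a) ∧ isArndt r

arndtCompositions : ℕ → List (List ℕ)
arndtCompositions n = filterᵇ isArndt (compositions n)

arndtCount : ℕ → ℕ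
arndtCount n = length (arndtCompositions n)

arndtTotalParts : ℕ → ℕ
arndtTotalParts n = sum (map length (arndtCompositions n))

-- p / d as a rational (d = 0 mapped to 0; never used for n ≥ 1)
_div_ : ℕ → ℕ → ℚ
p div zero    = 0ℚ
p div (suc d) = (+ p) / (suc d)

expectedParts : ℕ → ℚ
expectedParts n = arndtTotalParts n div arndtCount n

normalizedExpectedParts : ℕ → ℚ
normalizedExpectedParts n = arndtTotalParts n div (n ℕ.* arndtCount n)

-- Comparison of a rational q with the irrational 3/√5 (exact, via squaring):
-- q < 3/√5  iff  q < 0 or 5q² < 9 ;   3/√5 < q  iff  q > 0 and 9 < 5q².
_<3/√5 : ℚ → Set
q <3/√5 = (q < 0ℚ) ⊎ ((+ 5 / 1) * (q * q) < (+ 9 / 1))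

3/√5<_ : ℚ → Set
3/√5< q = (0ℚ < q) × ((+ 9 / 1) < (+ 5 / 1) * (q * q))

-- |r - (3/√5 - 1)| < ε, written as  r + 1 - ε < 3/√5 < r + 1 + ε
WithinOf3/√5-1 : ℚ → ℚ → Set
WithinOf3/√5-1 ε r = ((r + 1ℚ' - ε) <3/√5) × (3/√5< (r + 1ℚ' + ε))
  where 1ℚ' = + 1 / 1

-- Lowering the first two parts of an Arndt composition of n + 3 by one gives an Arndt
-- composition of n + 1, except when the second part is 1; those compositions are (a, 1)
-- followed by an arbitrary Arndt composition of size at most n, and [n + 3] corresponds to
-- [n + 1].  Summing a length-dependent weight over this decomposition shows that the number
-- of Arndt compositions of n is the Fibonacci number F n and that the total number of parts
-- T n satisfies T (n + 4) = T (n + 3) + T (n + 2) + 2 F (n + 1), whence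
-- 5 T n = 6 n F (n - 1) + 12 F n - 2 n F n - 15 F (n - 1) for n ≥ 2.  With the Lucas number
-- L = F n + 2 F (n - 1), for which L² = 5 F n² ± 4, this reads 5 (T n + n F n) = 3 n L + O (F n),
-- so (E[X(n)] / n + 1)² = 9 L² / (25 F n²) + O (1 / n) = 9 / 5 + O (1 / n).  As 3/√5 is
-- irrational, closeness to it is decided by comparing squares with 9/5, and all error terms
-- are explicit: n ≥ 5 + 16 q suffices for ε = p / q.

module Submission where

open import Defs

module Counting where

  open import Function using (_∘_; id; const)
  open import Data.Bool using (Bool; true; false; if_then_else_)
  open import Data.Nat using (ℕ; zero; suc; pred; _+_; _*_; _≤_; _<_; z≤n; s≤s; z<s; >-nonZero)
  open import Data.Nat.Properties
    using ( +-identityʳ; +-suc; +-assoc; +-comm; +-cancelʳ-≡; +-mono-≤; +-monoˡ-≤; +-monoʳ-≤; +-cancelʳ-≤; +-monoʳ-<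
          ; *-identityˡ; *-identityʳ; *-assoc; *-mono-≤; *-monoˡ-≤; *-monoʳ-≤; *-monoˡ-<; *-cancelˡ-<
          ; ≤-refl; ≤-reflexive; ≤-trans; m≤m+n; m<m+n )
  open Data.Nat.Properties.≤-Reasoning
  open import Data.Sum using (_⊎_; inj₁; inj₂)
  open import Data.Product using (_×_; _,_; proj₁; proj₂)
  open import Data.Nat.ListAction using (sum)
  open import Data.Nat.ListAction.Properties using (sum-++)
  open import Data.Nat.Tactic.RingSolver using (solve-∀)
  open import Data.List using (List; []; _∷_; map; _++_; concatMap; length; filterᵇ)
  open import Data.List.Properties using (map-++; map-∘)
  open import Relation.Binary.PropositionalEquality


  module _ {A : Set} where

    sum-map-cong : ∀ {f g : A → ℕ} → (∀ x → f x ≡ g x) → ∀ xs → sum (map f xs) ≡ sum (map g xs)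
    sum-map-cong f≗g []       = refl
    sum-map-cong f≗g (x ∷ xs) = cong₂ _+_ (f≗g x) (sum-map-cong f≗g xs)

    sum-map-+ : ∀ (f g : A → ℕ) xs → sum (map (λ x → f x + g x) xs) ≡ sum (map f xs) + sum (map g xs)
    sum-map-+ f g []       = refl
    sum-map-+ f g (x ∷ xs) = begin-equality
      f x + g x + sum (map (λ x → f x + g x) xs)         ≡⟨ cong (f x + g x +_) (sum-map-+ f g xs) ⟩
      f x + g x + (sum (map f xs) + sum (map g xs))      ≡⟨ interchange (f x) (g x) _ _ ⟩
      f x + sum (map f xs) + (g x + sum (map g xs))      ∎
      where
      interchange : ∀ a b c d → a + b + (c + d) ≡ a + c + (b + d)
      interchange = solve-∀

    sum-map-++ : ∀ (f : A → ℕ) xs ys → sum (map f (xs ++ ys)) ≡ sum (map f xs) + sum (map f ys)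
    sum-map-++ f xs ys = trans (cong sum (map-++ f xs ys)) (sum-++ (map f xs) (map f ys))

    sum-map-filterᵇ : ∀ (p : A → Bool) (f : A → ℕ) xs →
                      sum (map f (filterᵇ p xs)) ≡ sum (map (λ x → if p x then f x else 0) xs)
    sum-map-filterᵇ p f []       = refl
    sum-map-filterᵇ p f (x ∷ xs) with p x
    ... | true  = cong (f x +_) (sum-map-filterᵇ p f xs)
    ... | false = sum-map-filterᵇ p f xs

    length≡sum-map-1 : ∀ (xs : List A) → length xs ≡ sum (map (const 1) xs)
    length≡sum-map-1 []       = refl
    length≡sum-map-1 (x ∷ xs) = cong suc (length≡sum-map-1 xs)

    sum-map-concatMap : ∀ {B : Set} (f : A → ℕ) (g : B → List A) (h : B → ℕ) →
                        (∀ y → sum (map f (g y)) ≡ h y) →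
                        ∀ ys → sum (map f (concatMap g ys)) ≡ sum (map h ys)
    sum-map-concatMap f g h eq []       = refl
    sum-map-concatMap f g h eq (y ∷ ys) = begin-equality
      sum (map f (g y ++ concatMap g ys))              ≡⟨ sum-map-++ f (g y) (concatMap g ys) ⟩
      sum (map f (g y)) + sum (map f (concatMap g ys)) ≡⟨ cong₂ _+_ (eq y) (sum-map-concatMap f g h eq ys) ⟩
      h y + sum (map h ys)                             ∎

  compSum : (List ℕ → ℕ) → ℕ → ℕ
  compSum f n = sum (map f (compositions n))

  bumpHead : (List ℕ → ℕ) → List ℕ → ℕ
  bumpHead f []      = 0
  bumpHead f (a ∷ r) = f (suc a ∷ r)

  compSum-suc : ∀ f n → compSum f (suc n) ≡ compSum (f ∘ (1 ∷_)) n + compSum (bumpHead f) n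
  compSum-suc f n = begin-equality
    compSum f (suc n)
      ≡⟨ sum-map-++ f (map (1 ∷_) cs) _ ⟩
    sum (map f (map (1 ∷_) cs)) + _
      ≡⟨ cong₂ _+_ (cong sum (sym (map-∘ cs)))
                   (sum-map-concatMap f _ (bumpHead f) (λ { [] → refl ; (a ∷ r) → +-identityʳ (f (suc a ∷ r)) }) cs) ⟩
    compSum (f ∘ (1 ∷_)) n + compSum (bumpHead f) n
      ∎
    where
    cs : List (List ℕ)
    cs = compositions n

  compSum-cong : ∀ {f g} → (∀ c → f c ≡ g c) → ∀ n → compSum f n ≡ compSum g n
  compSum-cong f≗g n = sum-map-cong f≗g (compositions n)

  compSum-congⁿᵉ : ∀ {f g} → (∀ a r → f (a ∷ r) ≡ g (a ∷ r)) → ∀ n → compSum f (suc n) ≡ compSum g (suc n)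
  compSum-congⁿᵉ {f} {g} f≗g n = begin-equality
    compSum f (suc n)                                ≡⟨ compSum-suc f n ⟩
    compSum (f ∘ (1 ∷_)) n + compSum (bumpHead f) n  ≡⟨ cong₂ _+_ (compSum-cong (f≗g 1) n) (compSum-cong bumped n) ⟩
    compSum (g ∘ (1 ∷_)) n + compSum (bumpHead g) n  ≡⟨ compSum-suc g n ⟨
    compSum g (suc n)                                ∎
    where
    bumped : ∀ c → bumpHead f c ≡ bumpHead g c
    bumped []      = refl
    bumped (a ∷ r) = f≗g (suc a) r

  compSum-zero : ∀ {f} → (∀ c → f c ≡ 0) → ∀ n → compSum f n ≡ 0
  compSum-zero {f} f≗0 n = trans (compSum-cong f≗0 n) (sum-map-0 (compositions n))
    where
    sum-map-0 : ∀ (cs : List (List ℕ)) → sum (map (const 0) cs) ≡ 0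
    sum-map-0 []       = refl
    sum-map-0 (c ∷ cs) = sum-map-0 cs

  compSum-+ : ∀ f g n → compSum (λ c → f c + g c) n ≡ compSum f n + compSum g n
  compSum-+ f g n = sum-map-+ f g (compositions n)

  sumBelow : (ℕ → ℕ) → ℕ → ℕ
  sumBelow g zero    = 0
  sumBelow g (suc n) = sumBelow g n + g n

  arndtWeight : (ℕ → ℕ) → List ℕ → ℕ
  arndtWeight w c = if isArndt c then w (length c) else 0

  arndtSum : (ℕ → ℕ) → ℕ → ℕ
  arndtSum w = compSum (arndtWeight w)

  arndtCount≡arndtSum : ∀ n → arndtCount n ≡ arndtSum (const 1) n
  arndtCount≡arndtSum n =
    trans (length≡sum-map-1 (arndtCompositions n)) (sum-map-filterᵇ isArndt (const 1) (compositions n))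

  arndtTotalParts≡arndtSum : ∀ n → arndtTotalParts n ≡ arndtSum id n
  arndtTotalParts≡arndtSum n = sum-map-filterᵇ isArndt length (compositions n)

  -- startingWith k n is the weight of the Arndt compositions of k + 1 + n with first part
  -- k + 1, and startingAbove k n that of the Arndt compositions of n + k with first part
  -- exceeding k.
  module FirstPart (w : ℕ → ℕ) where

    startingWith : ℕ → ℕ → ℕ
    startingWith k = compSum (λ c → arndtWeight w (suc k ∷ c))

    raiseHead : ℕ → List ℕ → ℕ
    raiseHead k []      = 0
    raiseHead k (a ∷ r) = arndtWeight w (a + k ∷ r)

    startingAbove : ℕ → ℕ → ℕ
    startingAbove k = compSum (raiseHead k)

    G : ℕ → ℕ
    G = arndtSum (w ∘ (2 +_))

    startingAbove-suc : ∀ k n → startingAbove k (suc n) ≡ startingWith k n + startingAbove (suc k) n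
    startingAbove-suc k n = trans (compSum-suc (raiseHead k) n) (cong (startingWith k n +_) (compSum-cong bumped n))
      where
      bumped : ∀ c → bumpHead (raiseHead k) c ≡ raiseHead (suc k) c
      bumped []      = refl
      bumped (a ∷ r) = cong (λ x → arndtWeight w (x ∷ r)) (sym (+-suc a k))

    startingWith-1-suc : ∀ n → startingWith 0 (suc n) ≡ 0
    startingWith-1-suc n = begin-equality
      startingWith 0 (suc n)                      ≡⟨ compSum-suc _ n ⟩
      compSum (λ c → arndtWeight w (1 ∷ 1 ∷ c)) n + compSum (bumpHead (λ c → arndtWeight w (1 ∷ c))) n
        ≡⟨ cong₂ _+_ (compSum-zero (λ c → refl) n) (compSum-zero (λ { [] → refl ; (a ∷ r) → refl }) n) ⟩
      0                                           ∎

    startingWith-suc-suc : ∀ k n → startingWith (suc k) (suc (suc n)) ≡ G (suc n) + startingWith k (suc n)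
    startingWith-suc-suc k n =
      trans (compSum-suc _ (suc n)) (cong (G (suc n) +_) (compSum-congⁿᵉ (λ a r → refl) n))

    startingAbove-step : ∀ k n → startingAbove (suc k) (2 + n) ≡ startingAbove k (1 + n) + sumBelow G (1 + n)
    startingAbove-step k zero = rearrange (w 2) (w 1)   -- both sides reduce to w 1 + w 2 up to zeros
      where
      rearrange : ∀ a b → a + (b + 0) ≡ b + 0 + (a + 0)
      rearrange = solve-∀
    startingAbove-step k (suc n) = begin-equality
      startingAbove (suc k) (3 + n)
        ≡⟨ startingAbove-suc (suc k) (2 + n) ⟩
      startingWith (suc k) (2 + n) + startingAbove (2 + k) (2 + n)
        ≡⟨ cong₂ _+_ (startingWith-suc-suc k n) (startingAbove-step (suc k) n) ⟩
      G (1 + n) + startingWith k (1 + n) + (startingAbove (suc k) (1 + n) + sumBelow G (1 + n))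
        ≡⟨ rearrange (G (1 + n)) (startingWith k (1 + n)) _ _ ⟩
      startingWith k (1 + n) + startingAbove (suc k) (1 + n) + sumBelow G (2 + n)
        ≡⟨ cong (_+ sumBelow G (2 + n)) (startingAbove-suc k (1 + n)) ⟨
      startingAbove k (2 + n) + sumBelow G (2 + n)
        ∎
      where
      rearrange : ∀ g s a b → g + s + (a + b) ≡ s + a + (b + g)
      rearrange = solve-∀

    arndtSum-step : ∀ n → arndtSum w (3 + n) ≡ arndtSum w (1 + n) + sumBelow G (1 + n)
    arndtSum-step n = begin-equality
      arndtSum w (3 + n)                               ≡⟨ compSum-congⁿᵉ firstPart (2 + n) ⟩
      startingAbove 0 (3 + n)                          ≡⟨ startingAbove-suc 0 (2 + n) ⟩
      startingWith 0 (2 + n) + startingAbove 1 (2 + n) ≡⟨ cong₂ _+_ (startingWith-1-suc (1 + n)) (startingAbove-step 0 n) ⟩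
      startingAbove 0 (1 + n) + sumBelow G (1 + n)     ≡⟨ cong (_+ sumBelow G (1 + n)) (compSum-congⁿᵉ firstPart n) ⟨
      arndtSum w (1 + n) + sumBelow G (1 + n)          ∎
      where
      firstPart : ∀ a r → arndtWeight w (a ∷ r) ≡ raiseHead 0 (a ∷ r)
      firstPart a r = cong (λ x → arndtWeight w (x ∷ r)) (sym (+-identityʳ a))

  arndtSum-recurrence : ∀ w n → arndtSum w (4 + n) + arndtSum w (1 + n)
                                ≡ arndtSum w (3 + n) + arndtSum w (2 + n) + arndtSum (w ∘ (2 +_)) (1 + n)
  arndtSum-recurrence w n = begin-equality
    a (4 + n) + a (1 + n)                                      ≡⟨ cong (_+ a (1 + n)) (arndtSum-step (1 + n)) ⟩
    a (2 + n) + (sumBelow G (1 + n) + G (1 + n)) + a (1 + n)   ≡⟨ rearrange (a (2 + n)) _ (G (1 + n)) _ ⟩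
    a (1 + n) + sumBelow G (1 + n) + a (2 + n) + G (1 + n)     ≡⟨ cong (λ x → x + a (2 + n) + G (1 + n)) (arndtSum-step n) ⟨
    a (3 + n) + a (2 + n) + G (1 + n)                          ∎
    where
    open FirstPart w
    a : ℕ → ℕ
    a = arndtSum w
    rearrange : ∀ x s g y → x + (s + g) + y ≡ y + s + x + g
    rearrange = solve-∀

  fib : ℕ → ℕ
  fib 0             = 0
  fib 1             = 1
  fib (suc (suc n)) = fib (suc n) + fib n

  arndtSum-1-recurrence : ∀ n → arndtSum (const 1) (4 + n) ≡ arndtSum (const 1) (3 + n) + arndtSum (const 1) (2 + n)
  arndtSum-1-recurrence n = +-cancelʳ-≡ _ _ _ (arndtSum-recurrence (const 1) n)

  arndtSum-1≡fib : ∀ n → arndtSum (const 1) (suc n) ≡ fib (suc n)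
  arndtSum-1≡fib 0               = refl
  arndtSum-1≡fib 1               = refl
  arndtSum-1≡fib 2               = refl
  arndtSum-1≡fib (suc (suc (suc n))) =
    trans (arndtSum-1-recurrence n) (cong₂ _+_ (arndtSum-1≡fib (suc (suc n))) (arndtSum-1≡fib (suc n)))

  arndtCount≡fib : ∀ n → arndtCount (suc n) ≡ fib (suc n)
  arndtCount≡fib n = trans (arndtCount≡arndtSum (suc n)) (arndtSum-1≡fib n)

  arndtSum-2+ : ∀ n → arndtSum (2 +_) n ≡ arndtSum (const 1) n + arndtSum (const 1) n + arndtSum id n
  arndtSum-2+ n = begin-equality
    arndtSum (2 +_) n                                           ≡⟨ compSum-cong split n ⟩
    compSum (λ c → arndtWeight (const 1) c + arndtWeight (const 1) c + arndtWeight id c) n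
      ≡⟨ compSum-+ _ (arndtWeight id) n ⟩
    compSum (λ c → arndtWeight (const 1) c + arndtWeight (const 1) c) n + arndtSum id n
      ≡⟨ cong (_+ arndtSum id n) (compSum-+ (arndtWeight (const 1)) (arndtWeight (const 1)) n) ⟩
    arndtSum (const 1) n + arndtSum (const 1) n + arndtSum id n ∎
    where
    split : ∀ c → arndtWeight (2 +_) c ≡ arndtWeight (const 1) c + arndtWeight (const 1) c + arndtWeight id c
    split c with isArndt c
    ... | true  = refl
    ... | false = refl

  arndtSum-id-recurrence : ∀ n → arndtSum id (4 + n) ≡ arndtSum id (3 + n) + arndtSum id (2 + n) + 2 * fib (1 + n)
  arndtSum-id-recurrence n = +-cancelʳ-≡ (T (1 + n)) _ _ (begin-equality
    T (4 + n) + T (1 + n)                                ≡⟨ arndtSum-recurrence id n ⟩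
    T (3 + n) + T (2 + n) + arndtSum (2 +_) (1 + n) ≡⟨ cong (T (3 + n) + T (2 + n) +_) (arndtSum-2+ (1 + n)) ⟩
    T (3 + n) + T (2 + n) + (A (1 + n) + A (1 + n) + T (1 + n))
      ≡⟨ cong (λ x → T (3 + n) + T (2 + n) + (x + x + T (1 + n))) (arndtSum-1≡fib n) ⟩
    T (3 + n) + T (2 + n) + (fib (1 + n) + fib (1 + n) + T (1 + n)) ≡⟨ rearrange (T (3 + n)) (T (2 + n)) (fib (1 + n)) (T (1 + n)) ⟩
    T (3 + n) + T (2 + n) + 2 * fib (1 + n) + T (1 + n)  ∎)
    where
    T A : ℕ → ℕ
    T = arndtSum id
    A = arndtSum (const 1)
    rearrange : ∀ a b f t → a + b + (f + f + t) ≡ a + b + 2 * f + t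
    rearrange = solve-∀

  arndtSum-id-closedForm : ∀ k → 5 * arndtSum id (2 + k) + (2 * (2 + k) * fib (2 + k) + 15 * fib (1 + k))
                                ≡ 6 * (2 + k) * fib (1 + k) + 12 * fib (2 + k)
  arndtSum-id-closedForm 0             = refl
  arndtSum-id-closedForm 1             = refl
  arndtSum-id-closedForm (suc (suc k)) = +-cancelʳ-≡ (P 2 + P 3) _ _ (begin-equality
    5 * T (4 + k) + P 4 + (P 2 + P 3)
      ≡⟨ cong (λ t → 5 * t + P 4 + (P 2 + P 3)) (arndtSum-id-recurrence k) ⟩
    5 * (T (3 + k) + T (2 + k) + 2 * fib (1 + k)) + P 4 + (P 2 + P 3)
      ≡⟨ regroup (T (3 + k)) (T (2 + k)) (fib (1 + k)) (P 2) (P 3) (P 4) ⟩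
    (5 * T (3 + k) + P 3) + (5 * T (2 + k) + P 2) + (10 * fib (1 + k) + P 4)
      ≡⟨ cong₂ (λ a b → a + b + (10 * fib (1 + k) + P 4)) (arndtSum-id-closedForm (suc k)) (arndtSum-id-closedForm k) ⟩
    Q 3 + Q 2 + (10 * fib (1 + k) + P 4)
      ≡⟨ fibIdentity k (fib k) (fib (1 + k)) ⟩
    Q 4 + (P 2 + P 3)
      ∎)
    where
    T : ℕ → ℕ
    T = arndtSum id
    P Q : ℕ → ℕ
    P i = 2 * (i + k) * fib (i + k) + 15 * fib (pred (i + k))
    Q i = 6 * (i + k) * fib (pred (i + k)) + 12 * fib (i + k)
    regroup : ∀ t₃ t₂ f p₂ p₃ p₄ → 5 * (t₃ + t₂ + 2 * f) + p₄ + (p₂ + p₃) ≡ (5 * t₃ + p₃) + (5 * t₂ + p₂) + (10 * f + p₄)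
    regroup = solve-∀
    -- Q 3 + Q 2 + 10 F (1 + k) + P 4 ≡ Q 4 + P 2 + P 3, with every Fibonacci number
    -- expanded in x = fib k and y = fib (1 + k).
    fibIdentity : ∀ k x y →
      6 * (3 + k) * (y + x) + 12 * (y + x + y) + (6 * (2 + k) * y + 12 * (y + x))
        + (10 * y + (2 * (4 + k) * (y + x + y + (y + x)) + 15 * (y + x + y)))
      ≡ 6 * (4 + k) * (y + x + y) + 12 * (y + x + y + (y + x))
        + (2 * (2 + k) * (y + x) + 15 * y + (2 * (3 + k) * (y + x + y) + 15 * (y + x)))
    fibIdentity = solve-∀

  module LucasStep (F G : ℕ) where

    F′ L L′ : ℕ
    F′ = F + G
    L  = F + 2 * G
    L′ = F′ + 2 * F

    L′²+L²≡5F′²+5F² : L′ * L′ + L * L ≡ 5 * (F′ * F′) + 5 * (F * F)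
    L′²+L²≡5F′²+5F² = identity F G
      where
      identity : ∀ F G → (F + G + 2 * F) * (F + G + 2 * F) + (F + 2 * G) * (F + 2 * G) ≡ 5 * ((F + G) * (F + G)) + 5 * (F * F)
      identity = solve-∀

  L²≡5F²±4 : ℕ → ℕ → Set
  L²≡5F²±4 L F = L * L + 4 ≡ 5 * (F * F) ⊎ L * L ≡ 5 * (F * F) + 4

  L²≡5F²±4-step : ∀ F G → L²≡5F²±4 (F + 2 * G) F → L²≡5F²±4 (F + G + 2 * F) (F + G)
  L²≡5F²±4-step F G (inj₁ L²+4≡5F²) = inj₂ (+-cancelʳ-≡ (L * L) _ _ (begin-equality
    L′ * L′ + L * L               ≡⟨ L′²+L²≡5F′²+5F² ⟩
    5 * (F′ * F′) + 5 * (F * F)   ≡⟨ cong (5 * (F′ * F′) +_) L²+4≡5F² ⟨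
    5 * (F′ * F′) + (L * L + 4)   ≡⟨ swap (5 * (F′ * F′)) (L * L) ⟩
    5 * (F′ * F′) + 4 + L * L     ∎))
    where
    open LucasStep F G
    swap : ∀ a b → a + (b + 4) ≡ a + 4 + b
    swap = solve-∀
  L²≡5F²±4-step F G (inj₂ L²≡5F²+4) = inj₁ (+-cancelʳ-≡ (5 * (F * F)) _ _ (begin-equality
    L′ * L′ + 4 + 5 * (F * F)     ≡⟨ +-assoc (L′ * L′) 4 _ ⟩
    L′ * L′ + (4 + 5 * (F * F))   ≡⟨ cong (L′ * L′ +_) (trans (+-comm 4 _) (sym L²≡5F²+4)) ⟩
    L′ * L′ + L * L               ≡⟨ L′²+L²≡5F′²+5F² ⟩
    5 * (F′ * F′) + 5 * (F * F)   ∎))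
    where open LucasStep F G

  L²≡5F²±4-bounds : ∀ {L F} → L²≡5F²±4 L F → L * L ≤ 5 * (F * F) + 4 × 5 * (F * F) ≤ L * L + 4
  L²≡5F²±4-bounds {L} {F} (inj₁ L²+4≡5F²) =
    ≤-trans (m≤m+n (L * L) 4) (≤-trans (≤-reflexive L²+4≡5F²) (m≤m+n (5 * (F * F)) 4)) , ≤-reflexive (sym L²+4≡5F²)
  L²≡5F²±4-bounds {L} {F} (inj₂ L²≡5F²+4) =
    ≤-reflexive L²≡5F²+4 , ≤-trans (m≤m+n (5 * (F * F)) 4) (≤-trans (≤-reflexive (sym L²≡5F²+4)) (m≤m+n (L * L) 4))

  fib-lucas : ∀ k → L²≡5F²±4 (fib (suc k) + 2 * fib k) (fib (suc k))
  fib-lucas zero    = inj₁ refl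
  fib-lucas (suc k) = L²≡5F²±4-step (fib (suc k)) (fib k) (fib-lucas k)

  fib-mono : ∀ k → fib k ≤ fib (suc k)
  fib-mono zero    = z≤n
  fib-mono (suc k) = m≤m+n (fib (suc k)) (fib k)

  fib-pos : ∀ k → 1 ≤ fib (suc k)
  fib-pos zero    = ≤-refl
  fib-pos (suc k) = ≤-trans (fib-pos k) (fib-mono (suc k))

  n≤fib : ∀ k → 5 + k ≤ fib (5 + k)
  n≤fib zero    = ≤-refl
  n≤fib (suc k) = subst (_≤ fib (6 + k)) (+-comm (5 + k) 1) (+-mono-≤ (n≤fib k) (fib-pos (3 + k)))

  -- With T, F, G the total parts and the counts for n and n - 1, U / d is E[X(n)] / n + 1;
  -- the two main bounds say (U / d)² = 9 / 5 + O (1 / n).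
  module Estimate (n F G T : ℕ)
    (closedForm : 5 * T + (2 * n * F + 15 * G) ≡ 6 * n * G + 12 * F)
    (lucas : L²≡5F²±4 (F + 2 * G) F)
    (G≤F : G ≤ F) (1≤n : 1 ≤ n) (n≤F : n ≤ F) where

    U d e X : ℕ
    U = T + n * F
    d = n * F
    e = n * F * F
    X = 3 * n * (F + 2 * G)


    5U+15G≡X+12F : 5 * U + 15 * G ≡ X + 12 * F
    5U+15G≡X+12F = begin-equality
      5 * (T + n * F) + 15 * G                  ≡⟨ expand T n F G ⟩
      5 * T + (2 * n * F + 15 * G) + 3 * n * F  ≡⟨ cong (_+ 3 * n * F) closedForm ⟩
      6 * n * G + 12 * F + 3 * n * F            ≡⟨ collect n F G ⟩
      X + 12 * F                                ∎
      where
      expand : ∀ T n F G → 5 * (T + n * F) + 15 * G ≡ 5 * T + (2 * n * F + 15 * G) + 3 * n * F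
      expand = solve-∀
      collect : ∀ n F G → 6 * n * G + 12 * F + 3 * n * F ≡ 3 * n * (F + 2 * G) + 12 * F
      collect = solve-∀

    5U≤X+12F : 5 * U ≤ X + 12 * F
    5U≤X+12F = subst (5 * U ≤_) 5U+15G≡X+12F (m≤m+n (5 * U) (15 * G))

    X≤5U+3F : X ≤ 5 * U + 3 * F
    X≤5U+3F = +-cancelʳ-≤ (12 * F) X (5 * U + 3 * F) (begin
      X + 12 * F          ≡⟨ 5U+15G≡X+12F ⟨
      5 * U + 15 * G      ≤⟨ +-monoʳ-≤ (5 * U) (*-monoʳ-≤ 15 G≤F) ⟩
      5 * U + 15 * F      ≡⟨ split (5 * U) F ⟩
      5 * U + 3 * F + 12 * F ∎)
      where
      split : ∀ a F → a + 15 * F ≡ a + 3 * F + 12 * F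
      split = solve-∀

    m≤n*m : ∀ m → m ≤ n * m
    m≤n*m m = subst (_≤ n * m) (*-identityˡ m) (*-monoˡ-≤ m 1≤n)

    X≤9d : X ≤ 9 * d
    X≤9d = begin
      3 * n * (F + 2 * G) ≤⟨ *-monoʳ-≤ (3 * n) (+-monoʳ-≤ F (*-monoʳ-≤ 2 G≤F)) ⟩
      3 * n * (F + 2 * F) ≡⟨ triple n F ⟩
      9 * (n * F)         ∎
      where
      triple : ∀ n F → 3 * n * (F + 2 * F) ≡ 9 * (n * F)
      triple = solve-∀

    5U≤21d : 5 * U ≤ 21 * d
    5U≤21d = begin
      5 * U                  ≤⟨ 5U≤X+12F ⟩
      X + 12 * F             ≤⟨ +-mono-≤ X≤9d (*-monoʳ-≤ 12 (m≤n*m F)) ⟩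
      9 * d + 12 * d         ≡⟨ add d ⟩
      21 * d                 ∎
      where
      add : ∀ d → 9 * d + 12 * d ≡ 21 * d
      add = solve-∀

    L : ℕ
    L = F + 2 * G

    L²≤5F²+4 : L * L ≤ 5 * (F * F) + 4
    L²≤5F²+4 = proj₁ (L²≡5F²±4-bounds {L} {F} lucas)

    5F²≤L²+4 : 5 * (F * F) ≤ L * L + 4
    5F²≤L²+4 = proj₂ (L²≡5F²±4-bounds {L} {F} lucas)

    F²≤e : F * F ≤ e
    F²≤e = subst (F * F ≤_) (sym (*-assoc n F F)) (m≤n*m (F * F))

    n²≤e : n * n ≤ e
    n²≤e = begin
      n * n     ≤⟨ *-monoʳ-≤ n n≤F ⟩
      n * F     ≡⟨ *-identityʳ (n * F) ⟨
      n * F * 1 ≤⟨ *-monoʳ-≤ (n * F) (≤-trans 1≤n n≤F) ⟩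
      e         ∎

    125U²≤225d²+1980e : 125 * (U * U) ≤ 225 * (d * d) + 1980 * e
    125U²≤225d²+1980e = begin
      125 * (U * U)                                         ≡⟨ scale U ⟩
      5 * ((5 * U) * (5 * U))                               ≤⟨ *-monoʳ-≤ 5 (*-mono-≤ 5U≤X+12F 5U≤X+12F) ⟩
      5 * ((X + 12 * F) * (X + 12 * F))                     ≡⟨ expand n F G ⟩
      45 * (n * n) * (L * L) + 120 * X * F + 720 * (F * F)
        ≤⟨ +-mono-≤ (+-mono-≤ (*-monoʳ-≤ (45 * (n * n)) L²≤5F²+4) (*-monoˡ-≤ F (*-monoʳ-≤ 120 X≤9d))) (*-monoʳ-≤ 720 F²≤e) ⟩
      45 * (n * n) * (5 * (F * F) + 4) + 120 * (9 * d) * F + 720 * e ≡⟨ collect n F ⟩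
      225 * (d * d) + 180 * (n * n) + 1800 * e              ≤⟨ +-monoˡ-≤ (1800 * e) (+-monoʳ-≤ (225 * (d * d)) (*-monoʳ-≤ 180 n²≤e)) ⟩
      225 * (d * d) + 180 * e + 1800 * e                    ≡⟨ merge (225 * (d * d)) e ⟩
      225 * (d * d) + 1980 * e                              ∎
      where
      scale : ∀ U → 125 * (U * U) ≡ 5 * ((5 * U) * (5 * U))
      scale = solve-∀
      expand : ∀ n F G → 5 * ((3 * n * (F + 2 * G) + 12 * F) * (3 * n * (F + 2 * G) + 12 * F))
                         ≡ 45 * (n * n) * ((F + 2 * G) * (F + 2 * G)) + 120 * (3 * n * (F + 2 * G)) * F + 720 * (F * F)
      expand = solve-∀
      collect : ∀ n F → 45 * (n * n) * (5 * (F * F) + 4) + 120 * (9 * (n * F)) * F + 720 * (n * F * F)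
                        ≡ 225 * ((n * F) * (n * F)) + 180 * (n * n) + 1800 * (n * F * F)
      collect = solve-∀
      merge : ∀ a e → a + 180 * e + 1800 * e ≡ a + 1980 * e
      merge = solve-∀

    225d²≤125U²+1980e : 225 * (d * d) ≤ 125 * (U * U) + 1980 * e
    225d²≤125U²+1980e = begin
      225 * (d * d)                                ≡⟨ scale n F ⟩
      45 * (n * n) * (5 * (F * F))                 ≤⟨ *-monoʳ-≤ (45 * (n * n)) 5F²≤L²+4 ⟩
      45 * (n * n) * (L * L + 4)                   ≡⟨ expand n F G ⟩
      5 * (X * X) + 180 * (n * n)                  ≤⟨ +-mono-≤ (*-monoʳ-≤ 5 (*-mono-≤ X≤5U+3F X≤5U+3F)) (*-monoʳ-≤ 180 n²≤e) ⟩
      5 * ((5 * U + 3 * F) * (5 * U + 3 * F)) + 180 * e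
        ≡⟨ square U F e ⟩
      125 * (U * U) + 30 * (5 * U) * F + 45 * (F * F) + 180 * e
        ≤⟨ +-monoˡ-≤ (180 * e) (+-mono-≤ (+-monoʳ-≤ (125 * (U * U)) (*-monoˡ-≤ F (*-monoʳ-≤ 30 5U≤21d))) (*-monoʳ-≤ 45 F²≤e)) ⟩
      125 * (U * U) + 30 * (21 * d) * F + 45 * e + 180 * e ≡⟨ collect (125 * (U * U)) n F ⟩
      125 * (U * U) + 855 * e                      ≤⟨ +-monoʳ-≤ (125 * (U * U)) (*-monoˡ-≤ e (m≤m+n 855 1125)) ⟩
      125 * (U * U) + 1980 * e                     ∎
      where
      scale : ∀ n F → 225 * ((n * F) * (n * F)) ≡ 45 * (n * n) * (5 * (F * F))
      scale = solve-∀
      expand : ∀ n F G → 45 * (n * n) * ((F + 2 * G) * (F + 2 * G) + 4)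
                         ≡ 5 * ((3 * n * (F + 2 * G)) * (3 * n * (F + 2 * G))) + 180 * (n * n)
      expand = solve-∀
      square : ∀ U F e → 5 * ((5 * U + 3 * F) * (5 * U + 3 * F)) + 180 * e
                         ≡ 125 * (U * U) + 30 * (5 * U) * F + 45 * (F * F) + 180 * e
      square = solve-∀
      collect : ∀ a n F → a + 30 * (21 * (n * F)) * F + 45 * (n * F * F) + 180 * (n * F * F) ≡ a + 855 * (n * F * F)
      collect = solve-∀

  5aq<9qb+5pb : ∀ a b e p q → 125 * a ≤ 225 * b + 1980 * e → 1980 * q * e < 125 * p * b → 5 * a * q < 9 * q * b + 5 * p * b
  5aq<9qb+5pb a b e p q 125a≤ small = *-cancelˡ-< 25 _ _ (begin-strict
    25 * (5 * a * q)             ≡⟨ scale a q ⟩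
    125 * a * q                  ≤⟨ *-monoˡ-≤ q 125a≤ ⟩
    (225 * b + 1980 * e) * q     ≡⟨ distrib b e q ⟩
    225 * b * q + 1980 * q * e   <⟨ +-monoʳ-< (225 * b * q) small ⟩
    225 * b * q + 125 * p * b    ≡⟨ collect b p q ⟩
    25 * (9 * q * b + 5 * p * b)  ∎)
    where
    scale : ∀ a q → 25 * (5 * a * q) ≡ 125 * a * q
    scale = solve-∀
    distrib : ∀ b e q → (225 * b + 1980 * e) * q ≡ 225 * b * q + 1980 * q * e
    distrib = solve-∀
    collect : ∀ b p q → 225 * b * q + 125 * p * b ≡ 25 * (9 * q * b + 5 * p * b)
    collect = solve-∀

  9qb<5aq+5pb : ∀ a b e p q → 225 * b ≤ 125 * a + 1980 * e → 1980 * q * e < 125 * p * b → 9 * q * b < 5 * a * q + 5 * p * b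
  9qb<5aq+5pb a b e p q 225b≤ small = *-cancelˡ-< 25 _ _ (begin-strict
    25 * (9 * q * b)             ≡⟨ scale b q ⟩
    225 * b * q                  ≤⟨ *-monoˡ-≤ q 225b≤ ⟩
    (125 * a + 1980 * e) * q     ≡⟨ distrib a e q ⟩
    125 * a * q + 1980 * q * e   <⟨ +-monoʳ-< (125 * a * q) small ⟩
    125 * a * q + 125 * p * b    ≡⟨ collect a b p q ⟩
    25 * (5 * a * q + 5 * p * b) ∎)
    where
    scale : ∀ b q → 25 * (9 * q * b) ≡ 225 * b * q
    scale = solve-∀
    distrib : ∀ a e q → (125 * a + 1980 * e) * q ≡ 125 * a * q + 1980 * q * e
    distrib = solve-∀
    collect : ∀ a b p q → 125 * a * q + 125 * p * b ≡ 25 * (5 * a * q + 5 * p * b)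
    collect = solve-∀

  1980qe<125pb : ∀ n F p q → 1 ≤ F → 1 ≤ p → 5 + 16 * q ≤ n → 1980 * q * (n * F * F) < 125 * p * ((n * F) * (n * F))
  1980qe<125pb n F p q 1≤F 1≤p large = begin-strict
    1980 * q * e       <⟨ *-monoˡ-< e {{>-nonZero (*-mono-≤ (*-mono-≤ 1≤n 1≤F) 1≤F)}} 1980q<125pn ⟩
    125 * p * n * e    ≡⟨ regroup p n F ⟩
    125 * p * ((n * F) * (n * F)) ∎
    where
    e : ℕ
    e = n * F * F
    1≤n : 1 ≤ n
    1≤n = ≤-trans (s≤s z≤n) large
    1980q<125pn : 1980 * q < 125 * p * n
    1980q<125pn = begin-strict
      1980 * q                      <⟨ m<m+n (1980 * q) z<s ⟩
      1980 * q + (625 + 20 * q)     ≡⟨ collect q ⟩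
      125 * (5 + 16 * q)            ≤⟨ *-monoʳ-≤ 125 large ⟩
      125 * n                       ≤⟨ *-monoˡ-≤ n (*-monoʳ-≤ 125 1≤p) ⟩
      125 * p * n                   ∎
      where
      collect : ∀ q → 1980 * q + (625 + 20 * q) ≡ 125 * (5 + 16 * q)
      collect = solve-∀
    regroup : ∀ p n F → 125 * p * n * (n * F * F) ≡ 125 * p * ((n * F) * (n * F))
    regroup = solve-∀

module RationalBounds where

  open import Level using (0ℓ)
  open import Data.Maybe using (Maybe; just; nothing)
  open import Data.Nat as ℕ using (ℕ; suc)
  import Data.Nat.Properties as ℕ
  open import Data.Integer as ℤ using (+_)
  import Data.Integer.Properties as ℤ
  open import Data.Rational
  open import Data.Rational.Properties
  import Data.Rational.Unnormalised as ℚᵘ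
  import Data.Rational.Unnormalised.Properties as ℚᵘ
  open import Data.Sum using (inj₁; inj₂)
  open import Data.Product using (_,_)
  open import Relation.Nullary using (yes; no)
  open import Relation.Binary.PropositionalEquality
  open import Function using (id)
  import Tactic.RingSolver.Core.AlmostCommutativeRing as ACR
  open import Tactic.RingSolver using (solve-∀)


  ring : ACR.AlmostCommutativeRing 0ℓ 0ℓ
  ring = ACR.fromCommutativeRing +-*-commutativeRing isZero
    where
    isZero : ∀ x → Maybe (0ℚ ≡ x)
    isZero x with 0ℚ ≟ x
    ... | yes 0≡x = just 0≡x
    ... | no  _   = nothing

  ι : ℕ → ℚ
  ι m = + m / 1

  toℚᵘ-ι : ∀ m → toℚᵘ (ι m) ℚᵘ.≃ ℚᵘ.mkℚᵘ (+ m) 0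
  toℚᵘ-ι m = toℚᵘ-fromℚᵘ (ℚᵘ.mkℚᵘ (+ m) 0)

  ι-+ : ∀ a b → ι (a ℕ.+ b) ≡ ι a + ι b
  ι-+ a b = toℚᵘ-injective (begin
    toℚᵘ (ι (a ℕ.+ b))                 ≈⟨ toℚᵘ-ι (a ℕ.+ b) ⟩
    ℚᵘ.mkℚᵘ (+ (a ℕ.+ b)) 0            ≈⟨ ℚᵘ.*≡* (cong (ℤ._* + 1) (sym (cong₂ ℤ._+_ (ℤ.*-identityʳ (+ a)) (ℤ.*-identityʳ (+ b))))) ⟩
    ℚᵘ.mkℚᵘ (+ a) 0 ℚᵘ.+ ℚᵘ.mkℚᵘ (+ b) 0 ≈⟨ ℚᵘ.+-cong (toℚᵘ-ι a) (toℚᵘ-ι b) ⟨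
    toℚᵘ (ι a) ℚᵘ.+ toℚᵘ (ι b)         ≈⟨ toℚᵘ-homo-+ (ι a) (ι b) ⟨
    toℚᵘ (ι a + ι b)                   ∎)
    where open ℚᵘ.≃-Reasoning

  ι-* : ∀ a b → ι (a ℕ.* b) ≡ ι a * ι b
  ι-* a b = toℚᵘ-injective (begin
    toℚᵘ (ι (a ℕ.* b))                 ≈⟨ toℚᵘ-ι (a ℕ.* b) ⟩
    ℚᵘ.mkℚᵘ (+ (a ℕ.* b)) 0            ≈⟨ ℚᵘ.*≡* (cong (ℤ._* + 1) (ℤ.pos-* a b)) ⟩
    ℚᵘ.mkℚᵘ (+ a) 0 ℚᵘ.* ℚᵘ.mkℚᵘ (+ b) 0 ≈⟨ ℚᵘ.*-cong (toℚᵘ-ι a) (toℚᵘ-ι b) ⟨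
    toℚᵘ (ι a) ℚᵘ.* toℚᵘ (ι b)         ≈⟨ toℚᵘ-homo-* (ι a) (ι b) ⟨
    toℚᵘ (ι a * ι b)                   ∎)
    where open ℚᵘ.≃-Reasoning

  ι-< : ∀ {a b} → a ℕ.< b → ι a < ι b
  ι-< {a} {b} a<b = toℚᵘ-cancel-< (begin-strict
    toℚᵘ (ι a)              ≃⟨ toℚᵘ-ι a ⟩
    ℚᵘ.mkℚᵘ (+ a) 0         <⟨ ℚᵘ.*<* (subst₂ ℤ._<_ (sym (ℤ.*-identityʳ (+ a))) (sym (ℤ.*-identityʳ (+ b))) (ℤ.+<+ a<b)) ⟩
    ℚᵘ.mkℚᵘ (+ b) 0         ≃⟨ toℚᵘ-ι b ⟨
    toℚᵘ (ι b)              ∎)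
    where open ℚᵘ.≤-Reasoning

  /-*-ι : ∀ a d .{{_ : ℕ.NonZero d}} → (+ a / d) * ι d ≡ ι a
  /-*-ι a (suc d) = toℚᵘ-injective (begin
    toℚᵘ ((+ a / suc d) * ι (suc d))             ≈⟨ toℚᵘ-homo-* (+ a / suc d) (ι (suc d)) ⟩
    toℚᵘ (+ a / suc d) ℚᵘ.* toℚᵘ (ι (suc d))     ≈⟨ ℚᵘ.*-cong (toℚᵘ-fromℚᵘ (ℚᵘ.mkℚᵘ (+ a) d)) (toℚᵘ-ι (suc d)) ⟩
    ℚᵘ.mkℚᵘ (+ a) d ℚᵘ.* ℚᵘ.mkℚᵘ (+ suc d) 0     ≈⟨ ℚᵘ.*≡* (trans (ℤ.*-identityʳ _) (cong (λ z → + a ℤ.* + suc z) (sym (ℕ.*-identityʳ d)))) ⟩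
    ℚᵘ.mkℚᵘ (+ a) 0                             ≈⟨ toℚᵘ-ι a ⟨
    toℚᵘ (ι a)                                  ∎)
    where open ℚᵘ.≃-Reasoning

  [a/d+1]*d≡a+d : ∀ a d .{{_ : ℕ.NonZero d}} → (+ a / d + 1ℚ) * ι d ≡ ι (a ℕ.+ d)
  [a/d+1]*d≡a+d a d = begin
    (+ a / d + 1ℚ) * ι d           ≡⟨ *-distribʳ-+ (ι d) (+ a / d) 1ℚ ⟩
    (+ a / d) * ι d + 1ℚ * ι d     ≡⟨ cong₂ _+_ (/-*-ι a d) (*-identityˡ (ι d)) ⟩
    ι a + ι d                      ≡⟨ ι-+ a d ⟨
    ι (a ℕ.+ d)                    ∎
    where open ≡-Reasoning

  x≤x*a : ∀ x a → .{{NonNegative x}} → 1ℚ ≤ a → x ≤ x * a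
  x≤x*a x a 1≤a = subst (_≤ x * a) (*-identityʳ x) (*-monoˡ-≤-nonNeg x 1≤a)

  WithinOf3/√5-1-fromSquare : ∀ r ε → .{{Positive ε}} → 0ℚ ≤ r →
    ι 5 * ((r + 1ℚ) * (r + 1ℚ)) < ι 9 + ι 5 * ε →
    ι 9 < ι 5 * ((r + 1ℚ) * (r + 1ℚ)) + ι 5 * ε →
    WithinOf3/√5-1 ε r
  WithinOf3/√5-1-fromSquare r ε r≥0 5s²<9+5ε 9<5s²+5ε = below , (0<s+ε , above)
    where
    s : ℚ
    s = r + 1ℚ
    instance
      5ε≥0 : NonNegative (ι 5 * ε)
      5ε≥0 = nonNeg*nonNeg⇒nonNeg (ι 5) ε {{pos⇒nonNeg ε}}
    1≤s : 1ℚ ≤ s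
    1≤s = +-monoˡ-≤ 1ℚ r≥0
    0<s+ε : 0ℚ < s + ε
    0<s+ε = +-mono-≤-< (≤-trans (nonNegative⁻¹ 1ℚ) 1≤s) (positive⁻¹ ε)
    open ≤-Reasoning

    below : (s - ε) <3/√5
    below with (s - ε) <? 0ℚ
    ... | yes s-ε<0 = inj₁ s-ε<0
    ... | no  s-ε≮0 = inj₂ (begin-strict
      ι 5 * ((s - ε) * (s - ε))                      ≡⟨ expand s ε (ι 5) ⟩
      ι 5 * (s * s) - ι 5 * ε * (s + (s - ε))       ≤⟨ +-monoʳ-≤ (ι 5 * (s * s)) (neg-antimono-≤ (x≤x*a (ι 5 * ε) _ 1≤2s-ε)) ⟩
      ι 5 * (s * s) - ι 5 * ε                       <⟨ +-monoˡ-< (- (ι 5 * ε)) 5s²<9+5ε ⟩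
      ι 9 + ι 5 * ε - ι 5 * ε                       ≡⟨ cancel (ι 9) (ι 5 * ε) ⟩
      ι 9                                           ∎)
      where
      1≤2s-ε : 1ℚ ≤ s + (s - ε)
      1≤2s-ε = +-mono-≤ 1≤s (≮⇒≥ s-ε≮0)
      expand : ∀ s ε c → c * ((s - ε) * (s - ε)) ≡ c * (s * s) - c * ε * (s + (s - ε))
      expand = solve-∀ ring
      cancel : ∀ a b → a + b - b ≡ a
      cancel = solve-∀ ring

    above : ι 9 < ι 5 * ((s + ε) * (s + ε))
    above = begin-strict
      ι 9                                   <⟨ 9<5s²+5ε ⟩
      ι 5 * (s * s) + ι 5 * ε               ≤⟨ +-monoʳ-≤ (ι 5 * (s * s)) (x≤x*a (ι 5 * ε) _ 1≤2s+ε) ⟩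
      ι 5 * (s * s) + ι 5 * ε * (s + (s + ε)) ≡⟨ expand s ε (ι 5) ⟩
      ι 5 * ((s + ε) * (s + ε))             ∎
      where
      1≤2s+ε : 1ℚ ≤ s + (s + ε)
      1≤2s+ε = +-mono-≤ 1≤s (<⇒≤ 0<s+ε)
      expand : ∀ s ε c → c * (s * s) + c * ε * (s + (s + ε)) ≡ c * ((s + ε) * (s + ε))
      expand = solve-∀ ring

  ι-nonNeg : ∀ m → NonNegative (ι m)
  ι-nonNeg m = normalize-nonNeg m 1

  ι-*₃ : ∀ a b c → ι (a ℕ.* b ℕ.* c) ≡ ι a * ι b * ι c
  ι-*₃ a b c = trans (ι-* (a ℕ.* b) c) (cong (_* ι c) (ι-* a b))

  -- M clears the denominators of s² = U² / d² and ε = p / q.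
  module CrossMultiplied (s ε : ℚ) (U d p q : ℕ) (sd≡U : s * ι d ≡ ι U) (εq≡p : ε * ι q ≡ ι p) where

    M : ℚ
    M = ι d * ι d * ι q

    instance
      M≥0 : NonNegative M
      M≥0 = nonNeg*nonNeg⇒nonNeg (ι d * ι d) {{d²≥0}} (ι q) {{ι-nonNeg q}}
        where
        d²≥0 : NonNegative (ι d * ι d)
        d²≥0 = nonNeg*nonNeg⇒nonNeg (ι d) {{ι-nonNeg d}} (ι d) {{ι-nonNeg d}}

    open ≡-Reasoning

    5s²M : ι 5 * (s * s) * M ≡ ι (5 ℕ.* (U ℕ.* U) ℕ.* q)
    5s²M = begin
      ι 5 * (s * s) * (ι d * ι d * ι q)           ≡⟨ regroup s (ι d) (ι q) ⟩
      ι 5 * ((s * ι d) * (s * ι d)) * ι q         ≡⟨ cong (λ x → ι 5 * (x * x) * ι q) sd≡U ⟩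
      ι 5 * (ι U * ι U) * ι q                     ≡⟨ trans (ι-*₃ 5 (U ℕ.* U) q) (cong (λ x → ι 5 * x * ι q) (ι-* U U)) ⟨
      ι (5 ℕ.* (U ℕ.* U) ℕ.* q)                   ∎
      where
      regroup : ∀ s D Q → ι 5 * (s * s) * (D * D * Q) ≡ ι 5 * ((s * D) * (s * D)) * Q
      regroup = solve-∀ ring

    9M : ι 9 * M ≡ ι (9 ℕ.* q ℕ.* (d ℕ.* d))
    9M = begin
      ι 9 * (ι d * ι d * ι q)                     ≡⟨ regroup (ι d) (ι q) ⟩
      ι 9 * ι q * (ι d * ι d)                     ≡⟨ trans (ι-*₃ 9 q (d ℕ.* d)) (cong (ι 9 * ι q *_) (ι-* d d)) ⟨
      ι (9 ℕ.* q ℕ.* (d ℕ.* d))                   ∎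
      where
      regroup : ∀ D Q → ι 9 * (D * D * Q) ≡ ι 9 * Q * (D * D)
      regroup = solve-∀ ring

    5εM : ι 5 * ε * M ≡ ι (5 ℕ.* p ℕ.* (d ℕ.* d))
    5εM = begin
      ι 5 * ε * (ι d * ι d * ι q)                 ≡⟨ regroup ε (ι d) (ι q) ⟩
      ι 5 * (ε * ι q) * (ι d * ι d)               ≡⟨ cong (λ x → ι 5 * x * (ι d * ι d)) εq≡p ⟩
      ι 5 * ι p * (ι d * ι d)                     ≡⟨ trans (ι-*₃ 5 p (d ℕ.* d)) (cong (ι 5 * ι p *_) (ι-* d d)) ⟨
      ι (5 ℕ.* p ℕ.* (d ℕ.* d))                   ∎
      where
      regroup : ∀ ε D Q → ι 5 * ε * (D * D * Q) ≡ ι 5 * (ε * Q) * (D * D)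
      regroup = solve-∀ ring

    sumM : ∀ {x y a b} → x * M ≡ ι a → y * M ≡ ι b → (x + y) * M ≡ ι (a ℕ.+ b)
    sumM {x} {y} {a} {b} xM yM = trans (*-distribʳ-+ M x y) (trans (cong₂ _+_ xM yM) (sym (ι-+ a b)))

    cancelM : ∀ {x y a b} → x * M ≡ ι a → y * M ≡ ι b → a ℕ.< b → x < y
    cancelM xM yM a<b = *-cancelʳ-<-nonNeg M (subst₂ _<_ (sym xM) (sym yM) (ι-< a<b))

    5s²<9+5ε : 5 ℕ.* (U ℕ.* U) ℕ.* q ℕ.< 9 ℕ.* q ℕ.* (d ℕ.* d) ℕ.+ 5 ℕ.* p ℕ.* (d ℕ.* d) →
               ι 5 * (s * s) < ι 9 + ι 5 * ε
    5s²<9+5ε = cancelM 5s²M (sumM {ι 9} {ι 5 * ε} {9 ℕ.* q ℕ.* (d ℕ.* d)} {5 ℕ.* p ℕ.* (d ℕ.* d)} 9M 5εM)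

    9<5s²+5ε : 9 ℕ.* q ℕ.* (d ℕ.* d) ℕ.< 5 ℕ.* (U ℕ.* U) ℕ.* q ℕ.+ 5 ℕ.* p ℕ.* (d ℕ.* d) →
               ι 9 < ι 5 * (s * s) + ι 5 * ε
    9<5s²+5ε = cancelM 9M (sumM {ι 5 * (s * s)} {ι 5 * ε} {5 ℕ.* (U ℕ.* U) ℕ.* q} {5 ℕ.* p ℕ.* (d ℕ.* d)} 5s²M 5εM)

  open import Data.Nat.Coprimality using (Coprime)
  open Counting

  div-nonZero : ∀ a b .{{_ : ℕ.NonZero b}} → a div b ≡ + a / b
  div-nonZero a (suc b) = refl

  mkℚ-*-denominator : ∀ a b .(c : Coprime a (suc b)) → mkℚ (+ a) b c * ι (suc b) ≡ ι a
  mkℚ-*-denominator a b c = trans (cong (_* ι (suc b)) (sym (↥p/↧p≡p (mkℚ (+ a) b c)))) (/-*-ι a (suc b))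

  normalizedExpectedParts-within : ∀ ε p q → .{{Positive ε}} → ε * ι q ≡ ι p → 1 ℕ.≤ p →
    ∀ k → 5 ℕ.+ 16 ℕ.* q ℕ.≤ 5 ℕ.+ k → WithinOf3/√5-1 ε (normalizedExpectedParts (5 ℕ.+ k))
  normalizedExpectedParts-within ε p q εq≡p 1≤p k large =
    subst (WithinOf3/√5-1 ε) (sym nep≡r) (WithinOf3/√5-1-fromSquare r ε r≥0 (5s²<9+5ε upper) (9<5s²+5ε lower))
    where
    n F G T : ℕ
    n = 5 ℕ.+ k
    F = fib n
    G = fib (4 ℕ.+ k)
    T = arndtSum id n
    open Estimate n F G T (arndtSum-id-closedForm (3 ℕ.+ k)) (fib-lucas (4 ℕ.+ k)) (fib-mono (4 ℕ.+ k)) (ℕ.s≤s ℕ.z≤n) (n≤fib k)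
      using (U; d; e; 125U²≤225d²+1980e; 225d²≤125U²+1980e)
    instance
      d≢0 : ℕ.NonZero d
      d≢0 = ℕ.m*n≢0 n F {{_}} {{ℕ.>-nonZero (fib-pos (4 ℕ.+ k))}}
    r : ℚ
    r = + T / d
    nep≡r : normalizedExpectedParts n ≡ r
    nep≡r = trans (cong₂ (λ a b → a div (n ℕ.* b)) (arndtTotalParts≡arndtSum n) (arndtCount≡fib (4 ℕ.+ k))) (div-nonZero T d)
    r≥0 : 0ℚ ≤ r
    r≥0 = nonNegative⁻¹ r {{normalize-nonNeg T d}}
    sd≡U : (r + 1ℚ) * ι d ≡ ι U
    sd≡U = [a/d+1]*d≡a+d T d
    open CrossMultiplied (r + 1ℚ) ε U d p q sd≡U εq≡p
    small : 1980 ℕ.* q ℕ.* e ℕ.< 125 ℕ.* p ℕ.* (d ℕ.* d)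
    small = 1980qe<125pb n F p q (fib-pos (4 ℕ.+ k)) 1≤p large
    upper : 5 ℕ.* (U ℕ.* U) ℕ.* q ℕ.< 9 ℕ.* q ℕ.* (d ℕ.* d) ℕ.+ 5 ℕ.* p ℕ.* (d ℕ.* d)
    upper = 5aq<9qb+5pb (U ℕ.* U) (d ℕ.* d) e p q 125U²≤225d²+1980e small
    lower : 9 ℕ.* q ℕ.* (d ℕ.* d) ℕ.< 5 ℕ.* (U ℕ.* U) ℕ.* q ℕ.+ 5 ℕ.* p ℕ.* (d ℕ.* d)
    lower = 9qb<5aq+5pb (U ℕ.* U) (d ℕ.* d) e p q 225d²≤125U²+1980e small

open import Data.Nat using (ℕ; _≤_; suc; _+_; _*_; s≤s; z≤n)
open import Data.Nat.Properties using (m≤n⇒∃[o]m+o≡n; m≤m+n; ≤-trans)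
open import Data.Integer using (+[1+_])
open import Data.Rational using (ℚ; Positive; mkℚ)
open import Data.Product using (∃-syntax; _,_)
open import Relation.Binary.PropositionalEquality using (refl)
open RationalBounds using (normalizedExpectedParts-within; mkℚ-*-denominator)

theorem2p7 : (ε : ℚ) → Positive ε →
    ∃[ N ] ((n : ℕ) → 1 ≤ n → N ≤ n → WithinOf3/√5-1 ε (normalizedExpectedParts n))
theorem2p7 ε@(mkℚ +[1+ p ] q c) ε>0 = N , within
  where
  N : ℕ
  N = 5 + 16 * suc q
  within : (n : ℕ) → 1 ≤ n → N ≤ n → WithinOf3/√5-1 ε (normalizedExpectedParts n)
  within n _ N≤n with k , refl ← m≤n⇒∃[o]m+o≡n (≤-trans (m≤m+n 5 (16 * suc q)) N≤n) =
    normalizedExpectedParts-within ε (suc p) (suc q) {{ε>0}} (mkℚ-*-denominator (suc p) q c) (s≤s z≤n) k N≤n
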